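{- Let $G$ be a graph. For each $k\in\{1,\ldots,|V(G)|\}$, $\gamma_{\rm gr}^t(G)\le k+|V(G)|-\delta_k(G)$.
   Context: All graphs are finite and simple. For $U\subseteq V(G)$, $N(U)=\bigcup_{v\in U}N(v)$, where $N(v)$ is the open neighborhood of $v$, and $\delta_k(G)=\min\{|N(U)| : U\subseteq V(G),\ |U|=k\}$. A sequence $(v_1,\ldots,v_k)$ of distinct vertices is legal if for every $i\in\{1,\ldots,k\}$, $N(v_i)\setminus\bigcup_{j=1}^{i-1}N(v_j)\neq\emptyset$. $\gamma_{\rm gr}^t(G)$ is the maximum length of a legal sequence. -}

module Defs where

open import Data.Nat using (ℕ; _≤_)
open import Data.Fin using (Fin)
open import Data.Fin.Subset using (Subset; Side; inside; outside; _∈_; ∣_∣)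
open import Data.Fin.Subset.Properties using (_∈?_)
open import Data.Fin.Properties using (any?)
open import Data.Vec using (tabulate)
open import Data.Bool using (Bool; true; false)
open import Data.List using (List; []; _∷_; length)
open import Data.List.Relation.Unary.Unique.Propositional using (Unique)
open import Data.List.Relation.Unary.All using (All)
open import Data.Product using (Σ; _×_; ∃; ∃-syntax)
open import Relation.Nullary using (¬_; Dec; _×-dec_)
open import Relation.Nullary.Decidable using (does)
open import Relation.Binary using (Decidable)
open import Relation.Binary.PropositionalEquality using (_≡_)
open import Data.Unit using (⊤)

record Graph (n : ℕ) : Set₁ where
  field
    Adj     : Fin n → Fin n → Set
    adj?    : Decidable Adj
    sym     : ∀ {u v} → Adj u v → Adj v u
    irrefl  : ∀ {v} → ¬ Adj v v
open Graph public

toSide : Bool → Side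
toSide true  = inside
toSide false = outside

module _ {n : ℕ} (G : Graph n) where

  N : Subset n → Subset n
  N U = tabulate λ w → toSide (does (any? λ u → (u ∈? U) ×-dec (adj? G u w)))

  IsDelta : ℕ → ℕ → Set
  IsDelta k d =
    (Σ (Subset n) λ U → (∣ U ∣ ≡ k) × (∣ N U ∣ ≡ d))
    × (∀ (U : Subset n) → ∣ U ∣ ≡ k → d ≤ ∣ N U ∣)

  Footprints : List (Fin n) → Fin n → Set
  Footprints ps v = ∃[ w ] (Adj G v w × All (λ p → ¬ Adj G p w) ps)

  -- LegalRev qs : the list qs, read in REVERSE order (head = last vertex of
  -- the sequence), satisfies the legality condition.
  LegalRev : List (Fin n) → Set
  LegalRev []       = ⊤
  LegalRev (v ∷ ps) = Footprints ps v × LegalRev ps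

  Legal : List (Fin n) → Set
  Legal vs = Unique vs × LegalRev (Data.List.reverse vs)

  IsGammaGrT : ℕ → Set
  IsGammaGrT g =
    (Σ (List (Fin n)) λ vs → Legal vs × length vs ≡ g)
    × (∀ vs → Legal vs → length vs ≤ g)

-- Every vertex of a legal sequence has a footprint outside the neighbourhood of
-- its predecessors, so appending it enlarges that neighbourhood by at least one.
-- Hence if U is the set of the first k vertices of a legal sequence of length g,
-- the last g − k vertices add g − k new neighbours to N(U):
-- (g − k) + δ_k ≤ (g − k) + |N(U)| ≤ n.  Sequences shorter than k satisfy the
-- bound because δ_k ≤ n.
module Submission where

open import Defs
open import Data.Nat using (ℕ; suc; s≤s; _≤_; _<_; _+_; _∸_; _⊓_)
open import Data.Nat.Properties
  using (≤-refl; ≤-reflexive; ≤-trans; _≤?_; ≰⇒>; <⇒≤; +-mono-≤; +-monoʳ-≤; +-assoc; m+[n∸m]≡n; m+n≤o⇒m≤o∸n; m≤n⇒m⊓n≡m; module ≤-Reasoning)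
open import Data.Fin using (Fin; zero; suc)
open import Data.Fin.Subset using (Subset; inside; outside; _∈_; _∉_; _⊆_; ⁅_⁆; _∪_; ⋃; ∣_∣)
open import Data.Fin.Subset.Properties
  using (_∈?_; drop-not-there; ∣p∣≤n; ∣⊥∣≡0; ∉⊥; ∪-identityˡ; x∈⁅x⁆; x∈⁅y⁆⇒x≡y; x∈p∪q⁺; x∈p∪q⁻; q⊆p∪q; p⊆q⇒∣p∣≤∣q∣; p⊂q⇒∣p∣<∣q∣)
open import Data.Fin.Properties using (any?)
open import Data.Vec using (_∷_; here)
open import Data.Vec.Properties using ([]=⇒lookup; lookup⇒[]=; lookup∘tabulate)
open import Data.List using (List; []; _∷_; map; length; _++_; take; drop; reverse)
open import Data.List.Properties using (take++drop≡id; reverse-++; length-take; length-drop; length-reverse)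
open import Data.List.Membership.Propositional using () renaming (_∈_ to _∈ˡ_)
open import Data.List.Relation.Unary.Any using (here; there)
open import Data.List.Relation.Unary.Any.Properties using (reverse⁺)
open import Data.List.Relation.Unary.All as All using (_∷_)
open import Data.List.Relation.Unary.Unique.Propositional using (Unique)
open import Data.List.Relation.Unary.AllPairs using (_∷_)
open import Data.List.Relation.Unary.Unique.Propositional.Properties using (take⁺)
open import Data.Product using (∃; _×_; _,_)
open import Data.Sum using (inj₁; inj₂)
open import Relation.Nullary using (Dec; yes; no; _×-dec_; contradiction)
open import Relation.Nullary.Decidable using (does)
open import Relation.Binary.PropositionalEquality as ≡ using (_≡_; refl; trans; cong; subst)

fromList : ∀ {n} → List (Fin n) → Subset n
fromList xs = ⋃ (map ⁅_⁆ xs)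

module _ {n : ℕ} where

  x∈fromList⁻ : ∀ {x} {xs : List (Fin n)} → x ∈ fromList xs → x ∈ˡ xs
  x∈fromList⁻ {xs = []} x∈ = contradiction x∈ ∉⊥
  x∈fromList⁻ {xs = y ∷ xs} x∈ with x∈p∪q⁻ ⁅ y ⁆ (fromList xs) x∈
  ... | inj₁ x∈⁅y⁆ = here (x∈⁅y⁆⇒x≡y y x∈⁅y⁆)
  ... | inj₂ x∈xs  = there (x∈fromList⁻ x∈xs)

  x∈fromList⁺ : ∀ {x} {xs : List (Fin n)} → x ∈ˡ xs → x ∈ fromList xs
  x∈fromList⁺ {xs = y ∷ xs} (here refl) = x∈p∪q⁺ (inj₁ (x∈⁅x⁆ y))
  x∈fromList⁺ {xs = y ∷ xs} (there x∈) = x∈p∪q⁺ (inj₂ (x∈fromList⁺ x∈))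

  fromList-mono : ∀ {xs ys : List (Fin n)} → (∀ {x} → x ∈ˡ xs → x ∈ˡ ys) → fromList xs ⊆ fromList ys
  fromList-mono xs⊆ys x∈ = x∈fromList⁺ (xs⊆ys (x∈fromList⁻ x∈))

∣⁅x⁆∪p∣≡1+∣p∣ : ∀ {n} {x : Fin n} {p : Subset n} → x ∉ p → ∣ ⁅ x ⁆ ∪ p ∣ ≡ suc ∣ p ∣
∣⁅x⁆∪p∣≡1+∣p∣ {x = zero}  {inside  ∷ p} x∉p = contradiction here x∉p
∣⁅x⁆∪p∣≡1+∣p∣ {x = zero}  {outside ∷ p} _   = cong (λ q → suc ∣ q ∣) (∪-identityˡ p)
∣⁅x⁆∪p∣≡1+∣p∣ {x = suc x} {inside  ∷ p} x∉p = cong suc (∣⁅x⁆∪p∣≡1+∣p∣ (drop-not-there x∉p))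
∣⁅x⁆∪p∣≡1+∣p∣ {x = suc x} {outside ∷ p} x∉p = ∣⁅x⁆∪p∣≡1+∣p∣ (drop-not-there x∉p)

∣fromList∣≡length : ∀ {n} {xs : List (Fin n)} → Unique xs → ∣ fromList xs ∣ ≡ length xs
∣fromList∣≡length {n} {[]} _ = ∣⊥∣≡0 n
∣fromList∣≡length {xs = x ∷ xs} (x∉xs ∷ xs-unique) =
  trans (∣⁅x⁆∪p∣≡1+∣p∣ (λ x∈ → All.lookup x∉xs (x∈fromList⁻ x∈) refl))
        (cong suc (∣fromList∣≡length xs-unique))

toSide-does⁻ : ∀ {P : Set} (p? : Dec P) → toSide (does p?) ≡ inside → P
toSide-does⁻ (yes p) _ = p

toSide-does⁺ : ∀ {P : Set} (p? : Dec P) → P → toSide (does p?) ≡ inside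
toSide-does⁺ (yes _) _ = refl
toSide-does⁺ (no ¬p) p = contradiction p ¬p

module _ {n : ℕ} (G : Graph n) where

  private
    adjacent-to? : (U : Subset n) (w : Fin n) → Dec (∃ λ u → u ∈ U × Adj G u w)
    adjacent-to? U w = any? λ u → (u ∈? U) ×-dec adj? G u w

  ∈N⁻ : ∀ {U w} → w ∈ N G U → ∃ λ u → u ∈ U × Adj G u w
  ∈N⁻ {U} {w} w∈ = toSide-does⁻ (adjacent-to? U w) (trans (≡.sym (lookup∘tabulate _ w)) ([]=⇒lookup w∈))

  ∈N⁺ : ∀ {U u w} → u ∈ U → Adj G u w → w ∈ N G U
  ∈N⁺ {U} {u} {w} u∈U u~w =
    lookup⇒[]= w _ (trans (lookup∘tabulate _ w) (toSide-does⁺ (adjacent-to? U w) (u , u∈U , u~w)))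

  N-mono : ∀ {U V} → U ⊆ V → N G U ⊆ N G V
  N-mono U⊆V w∈ with u , u∈U , u~w ← ∈N⁻ w∈ = ∈N⁺ (U⊆V u∈U) u~w

  footprint⇒∣N∣< : ∀ {ps v} → Footprints G ps v → ∣ N G (fromList ps) ∣ < ∣ N G (fromList (v ∷ ps)) ∣
  footprint⇒∣N∣< {ps} {v} (w , v~w , ps≁w) =
    p⊂q⇒∣p∣<∣q∣ (N-mono (q⊆p∪q ⁅ v ⁆ (fromList ps)) , w , ∈N⁺ (x∈p∪q⁺ (inj₁ (x∈⁅x⁆ v))) v~w , w∉N)
    where
    w∉N : w ∉ N G (fromList ps)
    w∉N w∈ with u , u∈ps , u~w ← ∈N⁻ w∈ = All.lookup ps≁w (x∈fromList⁻ u∈ps) u~w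

  legalRev⇒∣N∣-grows : ∀ xs ps → LegalRev G (xs ++ ps) →
                        length xs + ∣ N G (fromList ps) ∣ ≤ ∣ N G (fromList (xs ++ ps)) ∣
  legalRev⇒∣N∣-grows []       ps _              = ≤-refl
  legalRev⇒∣N∣-grows (x ∷ xs) ps (footprint , legal) =
    ≤-trans (s≤s (legalRev⇒∣N∣-grows xs ps legal)) (footprint⇒∣N∣< footprint)

  suffix+∣N[prefix]∣≤n : ∀ as bs → LegalRev G (reverse (as ++ bs)) →
                         length bs + ∣ N G (fromList as) ∣ ≤ n
  suffix+∣N[prefix]∣≤n as bs legal = begin
    length bs + ∣ N G (fromList as) ∣
      ≤⟨ +-mono-≤ (≤-reflexive (≡.sym (length-reverse bs)))
                  (p⊆q⇒∣p∣≤∣q∣ (N-mono (fromList-mono {xs = as} {ys = reverse as} reverse⁺))) ⟩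
    length (reverse bs) + ∣ N G (fromList (reverse as)) ∣
      ≤⟨ legalRev⇒∣N∣-grows (reverse bs) (reverse as) (subst (LegalRev G) (reverse-++ as bs) legal) ⟩
    ∣ N G (fromList (reverse bs ++ reverse as)) ∣
      ≤⟨ ∣p∣≤n (N G (fromList (reverse bs ++ reverse as))) ⟩
    n ∎
    where open ≤-Reasoning

  legal⇒length+∣N[prefix]∣≤k+n : ∀ {k} vs → Legal G vs → k ≤ length vs →
                                 ∃ λ U → ∣ U ∣ ≡ k × length vs + ∣ N G U ∣ ≤ k + n
  legal⇒length+∣N[prefix]∣≤k+n {k} vs (unique , legal) k≤∣vs∣ = U , ∣U∣≡k , bound
    where
    open ≤-Reasoning
    U : Subset n
    U = fromList (take k vs)
    ∣NU∣ : ℕ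
    ∣NU∣ = ∣ N G U ∣
    ∣U∣≡k : ∣ U ∣ ≡ k
    ∣U∣≡k = begin-equality
      ∣ U ∣              ≡⟨ ∣fromList∣≡length (take⁺ k unique) ⟩
      length (take k vs) ≡⟨ length-take k vs ⟩
      k ⊓ length vs      ≡⟨ m≤n⇒m⊓n≡m k≤∣vs∣ ⟩
      k                  ∎
    legal′ : LegalRev G (reverse (take k vs ++ drop k vs))
    legal′ = subst (λ ws → LegalRev G (reverse ws)) (≡.sym (take++drop≡id k vs)) legal
    bound : length vs + ∣NU∣ ≤ k + n
    bound = begin
      length vs + ∣NU∣                 ≡⟨ cong (_+ ∣NU∣) (≡.sym (m+[n∸m]≡n k≤∣vs∣)) ⟩
      k + (length vs ∸ k) + ∣NU∣       ≡⟨ +-assoc k (length vs ∸ k) ∣NU∣ ⟩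
      k + (length vs ∸ k + ∣NU∣)       ≡⟨ cong (λ m → k + (m + ∣NU∣)) (≡.sym (length-drop k vs)) ⟩
      k + (length (drop k vs) + ∣NU∣)  ≤⟨ +-monoʳ-≤ k (suffix+∣N[prefix]∣≤n (take k vs) (drop k vs) legal′) ⟩
      k + n                            ∎

lemma3p4 : ∀ {n : ℕ} (G : Graph n) (k : ℕ) → 1 ≤ k → k ≤ n →
    ∀ (g d : ℕ) → IsGammaGrT G g → IsDelta G k d →
    g ≤ (k + n) ∸ d
lemma3p4 {n} G k _ _ g d ((vs , legal , refl) , _) ((U , _ , refl) , δ-minimal) =
  m+n≤o⇒m≤o∸n (length vs) length+δ≤k+n
  where
  length+δ≤k+n : length vs + ∣ N G U ∣ ≤ k + n
  length+δ≤k+n with k ≤? length vs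
  ... | yes k≤∣vs∣ with P , ∣P∣≡k , bound ← legal⇒length+∣N[prefix]∣≤k+n G vs legal k≤∣vs∣ =
    ≤-trans (+-monoʳ-≤ (length vs) (δ-minimal P ∣P∣≡k)) bound
  ... | no  k≰∣vs∣ = +-mono-≤ (<⇒≤ (≰⇒> k≰∣vs∣)) (∣p∣≤n (N G U))
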